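{- For every positive integer $n$, $|B_n(132,213,312)|=|B_n(213,231,312)|$.
   Context: A permutation $\sigma\in S_n$ is written as $\sigma(1)\cdots\sigma(n)$. An index $i\in[n-1]$ is an ascent if $\sigma(i)<\sigma(i+1)$ and a descent if $\sigma(i)>\sigma(i+1)$. A ballot permutation is a permutation such that every prefix $\sigma(1)\cdots\sigma(p)$ has at least as many ascents as descents. $\sigma$ contains a pattern $\pi\in S_k$ if some subsequence $\sigma(c_1)\cdots\sigma(c_k)$ with $c_1<\dots<c_k$ is order-isomorphic to $\pi$, and avoids $\pi$ otherwise. $B_n(\pi_1,\dots,\pi_m)$ denotes the set of ballot permutations of length $n$ avoiding all of $\pi_1,\dots,\pi_m$. -}

module Defs where

open import Data.Bool using (Bool; true; false; _∧_; _∨_; not)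
open import Data.Nat using (ℕ; zero; suc; _<ᵇ_; _≡ᵇ_; _+_)
open import Data.List using (List; []; _∷_; length; filter; map; concatMap; upTo; zip; tabulate; allFin; lookup; _++_)
open import Data.Bool.ListAction using (all; any)
open import Relation.Nullary.Decidable using (does)
open import Data.Bool.Properties using (T?)

-- Permutations of length n are taken on the values {0,…,n-1}
-- (relabelling values by -1 changes neither ascents/descents nor patterns).

words : ℕ → ℕ → List (List ℕ)
words m zero    = [] ∷ []
words m (suc n) = concatMap (λ x → map (x ∷_) (words m n)) (upTo m)

elemᵇ : ℕ → List ℕ → Bool
elemᵇ k w = any (λ x → k ≡ᵇ x) w

-- w is a permutation of {0,…,n-1}: length n and every k < n occurs
-- (hence each exactly once)
isPermᵇ : ℕ → List ℕ → Bool
isPermᵇ n w = (length w ≡ᵇ n) ∧ all (λ k → elemᵇ k w) (upTo n)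

perms : ℕ → List (List ℕ)
perms n = filter (λ w → T? (isPermᵇ n w)) (words n n)

-- Walk through w keeping d = (#ascents − #descents) of the
-- prefix read so far; it must never become negative.
ballotFrom : ℕ → ℕ → List ℕ → Bool
ballotFrom d prev []      = true
ballotFrom d prev (x ∷ w) with prev <ᵇ x
... | true  = ballotFrom (suc d) x w
... | false with d
...   | zero  = false
...   | suc d' = ballotFrom d' x w

isBallotᵇ : List ℕ → Bool
isBallotᵇ []      = true
isBallotᵇ (x ∷ w) = ballotFrom zero x w

subseqs : List ℕ → List (List ℕ)
subseqs []      = [] ∷ []
subseqs (x ∷ w) = map (x ∷_) (subseqs w) ++ subseqs w

orderIsoᵇ : List ℕ → List ℕ → Bool
orderIsoᵇ u v =
  (length u ≡ᵇ length v) ∧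
  all (λ p → all (λ q → bEq (proj1 p <ᵇ proj1 q) (proj2 p <ᵇ proj2 q)) ps) ps
  where
  open import Data.Product using (_×_; _,_) renaming (proj₁ to proj1; proj₂ to proj2)
  ps : List (ℕ × ℕ)
  ps = zip u v
  bEq : Bool → Bool → Bool
  bEq a b = (a ∧ b) ∨ (not a ∧ not b)

containsᵇ : List ℕ → List ℕ → Bool
containsᵇ σ π = any (λ s → orderIsoᵇ s π) (subseqs σ)

avoidsAllᵇ : List ℕ → List (List ℕ) → Bool
avoidsAllᵇ σ πs = all (λ π → not (containsᵇ σ π)) πs

B : ℕ → List (List ℕ) → List (List ℕ)
B n πs = filter (λ σ → T? (isBallotᵇ σ ∧ avoidsAllᵇ σ πs)) (perms n)

∣B∣ : ℕ → List (List ℕ) → ℕ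
∣B∣ n πs = length (B n πs)

-- A permutation avoiding 132, 213 and 312 is determined by its first entry x: after x the
-- larger entries increase (no 132), the smaller ones decrease (no 312), and no smaller entry
-- precedes a larger one (no 213), so it is x, x+1, …, n−1, x−1, …, 0.  It is ballot iff its
-- x descents never outnumber its n−1−x ascents, i.e. x ≤ n−1−x.  The patterns 213, 231, 312
-- are the reverses of 312, 132, 213, so the second class consists of the reversed shapes
-- 0, 1, …, y−1, n−1, …, y, which are ballot iff n−1−y ≤ y.  Setting y = n−1−x turns one
-- condition into the other, so both classes are indexed by {x < n ∣ x ≤ n−1−x}.
module Submission where

open import Defs
open import Data.Bool using (Bool; true; false; T; _∧_; _∨_; not)
open import Data.Bool.Properties using (T?; T-∧; T-≡; T-not-≡)
open import Data.Bool.ListAction using (all)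
open import Data.Empty using (⊥-elim)
open import Data.List using (List; []; _∷_; [_]; _++_; length; map; zip; upTo; reverse; filter; deduplicate)
open import Data.List.Properties
  using (length-map; length-++; length-reverse; length-upTo; length-filter; length-deduplicate;
         filter-complete; reverse-map; reverse-++; unfold-reverse; reverse-involutive; reverse-injective;
         ∷-injectiveˡ; ∷-injectiveʳ)
open import Data.List.Membership.Propositional using (_∈_; find; lose)
open import Data.List.Membership.Propositional.Properties
  using (∈-++⁺ˡ; ∈-++⁺ʳ; ∈-++⁻; ∈-map⁺; ∈-map⁻; ∈-concatMap⁺; ∈-concatMap⁻; ∈-upTo⁺; ∈-upTo⁻;
         ∈-filter⁺; ∈-filter⁻; ∈-deduplicate⁺; ∈-deduplicate⁻)
open import Data.List.Membership.Propositional.Properties.WithK using (unique∧set⇒bag)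
open import Data.List.Relation.Binary.BagAndSetEquality using (∼bag⇒↭)
open import Data.List.Relation.Binary.Disjoint.Propositional using (Disjoint)
open import Data.List.Relation.Binary.Permutation.Propositional.Properties using (↭-length)
open import Data.List.Relation.Binary.Sublist.Propositional using (_⊆_; []; _∷_; _∷ʳ_; ⊆-trans; to∈; from∈)
open import Data.List.Relation.Binary.Sublist.Propositional.Properties using (reverse⁻)
open import Data.List.Relation.Unary.All as All using (All; []; _∷_)
import Data.List.Relation.Unary.All.Properties as Allₚ
open Allₚ using (all⁺; all⁻)
open import Data.List.Relation.Unary.AllPairs as AllPairs using (AllPairs; []; _∷_)
import Data.List.Relation.Unary.AllPairs.Properties as AllPairsₚ
open import Data.List.Relation.Unary.Any as Any using (here; there)
open import Data.List.Relation.Unary.Any.Properties using (any⁺; any⁻)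
  renaming (reverse⁺ to ∈-reverse⁺; reverse⁻ to ∈-reverse⁻)
open import Data.List.Relation.Unary.Unique.Propositional using (Unique)
import Data.List.Relation.Unary.Unique.Propositional.Properties as Unique
import Data.Nat
open import Data.Nat using (ℕ; zero; suc; _+_; _∸_; _≤_; _<_; _<ᵇ_; z≤n; s≤s; z<s)
open import Data.Nat.Properties
  using (_≟_; _≤?_; ≡ᵇ⇒≡; ≡⇒≡ᵇ; <ᵇ⇒<; <⇒<ᵇ; <ᵇ-reflects-<; <-cmp; ≤-refl; ≤-antisym; ≤-pred;
         <-trans; <-≤-trans; <-irrefl; <-asym; <⇒≤; <⇒≱; <⇒≯; ≮⇒≥; ≤∧≢⇒<; m≤n⇒m≤1+n; n<1+n; suc-injective;
         +-comm; +-suc; +-identityʳ; m≤m+n; m<m+n; m+[n∸m]≡n; m∸n≤m; m∸[m∸n]≡n)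
open import Data.List.Relation.Unary.Unique.DecPropositional.Properties _≟_ using (deduplicate-!)
open import Data.Product as Product using (∃-syntax; _×_; _,_; proj₁; proj₂; map₂)
open import Data.Sum using (_⊎_; inj₁; inj₂)
open import Function using (_∘_; _⇔_; mk⇔; Equivalence)
open import Function.Properties.Equivalence using () renaming (sym to ⇔-sym; trans to ⇔-trans)
open import Relation.Binary.Definitions using (Asymmetric; DecidableEquality; tri<; tri≈; tri>)
open import Relation.Binary.PropositionalEquality
  using (_≡_; _≢_; refl; sym; trans; cong; cong₂; subst; module ≡-Reasoning)
open import Relation.Nullary using (Dec; ¬_; ¬?; yes; no)
open import Relation.Nullary.Reflects using (det; fromEquivalence)

open Equivalence using (to; from)
open ≡-Reasoning

T-not : ∀ {b} → T (not b) ⇔ (¬ T b)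
T-not {true}  = mk⇔ (λ ()) (λ ¬⊤ → ¬⊤ _)
T-not {false} = mk⇔ (λ _ ()) (λ _ → _)

<ᵇ≡true : ∀ {m n} → m < n → (m <ᵇ n) ≡ true
<ᵇ≡true = to T-≡ ∘ <⇒<ᵇ

<ᵇ≡false : ∀ {m n} → ¬ m < n → (m <ᵇ n) ≡ false
<ᵇ≡false m≮n = to T-not-≡ (from T-not (m≮n ∘ <ᵇ⇒< _ _))

T-<ᵇ-suc : ∀ {m n} → T (m <ᵇ suc n) ⇔ m ≤ n
T-<ᵇ-suc = mk⇔ (≤-pred ∘ <ᵇ⇒< _ _) (<⇒<ᵇ ∘ s≤s)

elemᵇ⇔∈ : ∀ {k w} → T (elemᵇ k w) ⇔ k ∈ w
elemᵇ⇔∈ {k} {w} = mk⇔ (Any.map (≡ᵇ⇒≡ _ _) ∘ any⁻ _ w) (any⁺ _ ∘ Any.map (≡⇒≡ᵇ _ _))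

∈-subseqs⁺ : ∀ {s σ} → s ⊆ σ → s ∈ subseqs σ
∈-subseqs⁺ []                   = here refl
∈-subseqs⁺ {σ = y ∷ σ} (_ ∷ʳ p) = ∈-++⁺ʳ (map (y ∷_) (subseqs σ)) (∈-subseqs⁺ p)
∈-subseqs⁺ (refl ∷ p)           = ∈-++⁺ˡ (∈-map⁺ _ (∈-subseqs⁺ p))

∈-subseqs⁻ : ∀ {s} σ → s ∈ subseqs σ → s ⊆ σ
∈-subseqs⁻ []      (here refl) = []
∈-subseqs⁻ (y ∷ σ) s∈ with ∈-++⁻ (map (y ∷_) (subseqs σ)) s∈
... | inj₂ s∈′ = y ∷ʳ ∈-subseqs⁻ σ s∈′
... | inj₁ ys∈ with ∈-map⁻ (y ∷_) ys∈
...   | _ , s∈′ , refl = refl ∷ ∈-subseqs⁻ σ s∈′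

agrees : Bool → Bool → Bool
agrees a b = (a ∧ b) ∨ (not a ∧ not b)

agrees⇒ : ∀ {a b} → T (agrees a b) → T b → T a
agrees⇒ {true}          _ _ = _
agrees⇒ {false} {false} _ ()

≡⇒agrees : ∀ {a b} → a ≡ b → T (agrees a b)
≡⇒agrees {true}  refl = _
≡⇒agrees {false} refl = _

OrderReflecting : List ℕ → List ℕ → Set
OrderReflecting u v = ∀ {a b i j} → (a , i) ∈ zip u v → (b , j) ∈ zip u v → T (i <ᵇ j) → a < b

orderIso-length : ∀ u v → T (orderIsoᵇ u v) → length u ≡ length v
orderIso-length u v iso = ≡ᵇ⇒≡ _ _ (proj₁ (to T-∧ iso))

orderIso⇒reflecting : ∀ u v → T (orderIsoᵇ u v) → OrderReflecting u v
orderIso⇒reflecting u v iso {a} {b} {i} {j} ai bj i<j = <ᵇ⇒< a b (agrees⇒ agreement i<j)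
  where
  agreement : T (agrees (a <ᵇ b) (i <ᵇ j))
  agreement = All.lookup (all⁺ _ (zip u v) (All.lookup (all⁺ _ (zip u v) (proj₂ (to T-∧ iso))) ai)) bj

∈-zip-map : ∀ {A B : Set} {f : A → B} {v a i} → (a , i) ∈ zip (map f v) v → a ≡ f i × i ∈ v
∈-zip-map {v = _ ∷ _} (here refl) = refl , here refl
∈-zip-map {v = _ ∷ _} (there p)   = map₂ there (∈-zip-map p)

orderIso-map : ∀ (f : ℕ → ℕ) v → (∀ {i j} → i ∈ v → j ∈ v → i < j → f i < f j) →
               T (orderIsoᵇ (map f v) v)
orderIso-map f v mono =
  from T-∧ (≡⇒≡ᵇ _ _ (length-map f v) , all⁻ _ (All.tabulate λ p → all⁻ _ (All.tabulate λ q → row p q)))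
  where
  reflects : ∀ {i j} → i ∈ v → j ∈ v → f i < f j → i < j
  reflects {i} {j} i∈ j∈ fi<fj with <-cmp i j
  ... | tri< i<j _ _  = i<j
  ... | tri≈ _ refl _ = ⊥-elim (<-irrefl refl fi<fj)
  ... | tri> _ _ j<i  = ⊥-elim (<-asym fi<fj (mono j∈ i∈ j<i))
  row : ∀ {a i b j} → (a , i) ∈ zip (map f v) v → (b , j) ∈ zip (map f v) v → T (agrees (a <ᵇ b) (i <ᵇ j))
  row p q with ∈-zip-map p | ∈-zip-map q
  ... | refl , i∈ | refl , j∈ =
    ≡⇒agrees (det (<ᵇ-reflects-< _ _) (fromEquivalence (mono i∈ j∈ ∘ <ᵇ⇒< _ _) (<⇒<ᵇ ∘ reflects i∈ j∈)))

-- Patterns of length three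

pattern first  = here refl
pattern second = there (here refl)
pattern third  = there (there (here refl))

triple : ℕ → ℕ → ℕ → ℕ → ℕ
triple x y z 1 = x
triple x y z 2 = y
triple x y z _ = z

triple-< : ∀ {x y z i j} → x < y → y < z → i ∈ 1 ∷ 2 ∷ 3 ∷ [] → j ∈ 1 ∷ 2 ∷ 3 ∷ [] → i < j →
           triple x y z i < triple x y z j
triple-< x<y y<z first  second _ = x<y
triple-< x<y y<z first  third  _ = <-trans x<y y<z
triple-< x<y y<z second third  _ = y<z
triple-< _   _   first  first  (s≤s ())
triple-< _   _   second first  (s≤s ())
triple-< _   _   second second (s≤s (s≤s ()))
triple-< _   _   third  first  (s≤s ())
triple-< _   _   third  second (s≤s (s≤s ()))
triple-< _   _   third  third  (s≤s (s≤s (s≤s ())))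

Occurrence : List ℕ → List ℕ → Set
Occurrence π s = ∃[ x ] ∃[ y ] ∃[ z ] x < y × y < z × s ≡ map (triple x y z) π

Contains : List ℕ → List ℕ → Set
Contains π σ = ∃[ s ] s ⊆ σ × Occurrence π s

Avoids : List ℕ → List ℕ → Set
Avoids π σ = ¬ Contains π σ

AvoidsAll : List (List ℕ) → List ℕ → Set
AvoidsAll πs σ = All (λ π → Avoids π σ) πs

record Pattern₃ (π : List ℕ) : Set where
  field
    triple-length : length π ≡ 3
    entries       : T (all (λ i → elemᵇ i (1 ∷ 2 ∷ 3 ∷ [])) π)
    decode        : ∀ {a b c} → OrderReflecting (a ∷ b ∷ c ∷ []) π → Occurrence π (a ∷ b ∷ c ∷ [])

length≡3⇒triple : ∀ {s : List ℕ} → length s ≡ 3 → ∃[ a ] ∃[ b ] ∃[ c ] s ≡ a ∷ b ∷ c ∷ []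
length≡3⇒triple {a ∷ b ∷ c ∷ []} refl = a , b , c , refl

module _ {π} (P : Pattern₃ π) where
  open Pattern₃ P

  contains⇔ : ∀ {σ} → T (containsᵇ σ π) ⇔ Contains π σ
  contains⇔ {σ} = mk⇔ decodeSubsequence encode
    where
    decodeSubsequence : T (containsᵇ σ π) → Contains π σ
    decodeSubsequence c with find (any⁻ (λ s → orderIsoᵇ s π) (subseqs σ) c)
    ... | s , s∈ , iso with length≡3⇒triple {s} (trans (orderIso-length s π iso) triple-length)
    ...   | _ , _ , _ , refl = s , ∈-subseqs⁻ σ s∈ , decode (orderIso⇒reflecting s π iso)
    encode : Contains π σ → T (containsᵇ σ π)
    encode (_ , p , x , y , z , x<y , y<z , refl) = any⁺ (λ s → orderIsoᵇ s π)
      (lose (∈-subseqs⁺ p) (orderIso-map (triple x y z) π λ i∈ j∈ → triple-< x<y y<z (entry i∈) (entry j∈)))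
      where
      entry : ∀ {i} → i ∈ π → i ∈ 1 ∷ 2 ∷ 3 ∷ []
      entry = to elemᵇ⇔∈ ∘ All.lookup (all⁺ (λ i → elemᵇ i (1 ∷ 2 ∷ 3 ∷ [])) π entries)

  avoids⇔ : ∀ {σ} → T (not (containsᵇ σ π)) ⇔ Avoids π σ
  avoids⇔ = mk⇔ (λ a → to T-not a ∘ from contains⇔) (λ a → from T-not (a ∘ to contains⇔))

avoidsAll⇔ : ∀ {πs σ} → All Pattern₃ πs → T (avoidsAllᵇ σ πs) ⇔ AvoidsAll πs σ
avoidsAll⇔ {πs} {σ} Ps = mk⇔
  (λ t → All.zipWith (λ (P , t) → to (avoids⇔ P) t) (Ps , all⁺ (λ π → not (containsᵇ σ π)) πs t))
  (λ a → all⁻ (λ π → not (containsᵇ σ π)) (All.zipWith (λ (P , a) → from (avoids⇔ P) a) (Ps , a)))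

pattern132 : Pattern₃ (1 ∷ 3 ∷ 2 ∷ [])
pattern132 = record
  { triple-length = refl
  ; entries       = _
  ; decode        = λ lt → _ , _ , _ , lt first third _ , lt third second _ , refl
  }

pattern213 : Pattern₃ (2 ∷ 1 ∷ 3 ∷ [])
pattern213 = record
  { triple-length = refl
  ; entries       = _
  ; decode        = λ lt → _ , _ , _ , lt second first _ , lt first third _ , refl
  }

pattern312 : Pattern₃ (3 ∷ 1 ∷ 2 ∷ [])
pattern312 = record
  { triple-length = refl
  ; entries       = _
  ; decode        = λ lt → _ , _ , _ , lt second third _ , lt third first _ , refl
  }

pattern231 : Pattern₃ (2 ∷ 3 ∷ 1 ∷ [])
pattern231 = record
  { triple-length = refl
  ; entries       = _
  ; decode        = λ lt → _ , _ , _ , lt third first _ , lt first second _ , refl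
  }

Π₁ Π₂ : List (List ℕ)
Π₁ = (1 ∷ 3 ∷ 2 ∷ []) ∷ (2 ∷ 1 ∷ 3 ∷ []) ∷ (3 ∷ 1 ∷ 2 ∷ []) ∷ []
Π₂ = (2 ∷ 1 ∷ 3 ∷ []) ∷ (2 ∷ 3 ∷ 1 ∷ []) ∷ (3 ∷ 1 ∷ 2 ∷ []) ∷ []

Π₁-patterns : All Pattern₃ Π₁
Π₁-patterns = pattern132 ∷ pattern213 ∷ pattern312 ∷ []

Π₂-patterns : All Pattern₃ Π₂
Π₂-patterns = pattern213 ∷ pattern231 ∷ pattern312 ∷ []

Avoids-reverse : ∀ {π σ} → Avoids π σ → Avoids (reverse π) (reverse σ)
Avoids-reverse {π} {σ} avoid (_ , s⊆ , x , y , z , x<y , y<z , refl) =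
  avoid (_ , reverse⁻ (subst (_⊆ reverse σ) (reverse-map (triple x y z) π) s⊆) , x , y , z , x<y , y<z , refl)

AvoidsAll-Π₁-reverse : ∀ {σ} → AvoidsAll Π₁ σ → AvoidsAll Π₂ (reverse σ)
AvoidsAll-Π₁-reverse (avoid132 ∷ avoid213 ∷ avoid312 ∷ []) =
  Avoids-reverse {3 ∷ 1 ∷ 2 ∷ []} avoid312 ∷ Avoids-reverse {1 ∷ 3 ∷ 2 ∷ []} avoid132 ∷
  Avoids-reverse {2 ∷ 1 ∷ 3 ∷ []} avoid213 ∷ []

AvoidsAll-Π₂-reverse : ∀ {σ} → AvoidsAll Π₂ σ → AvoidsAll Π₁ (reverse σ)
AvoidsAll-Π₂-reverse (avoid213 ∷ avoid231 ∷ avoid312 ∷ []) =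
  Avoids-reverse {2 ∷ 3 ∷ 1 ∷ []} avoid231 ∷ Avoids-reverse {3 ∷ 1 ∷ 2 ∷ []} avoid312 ∷
  Avoids-reverse {2 ∷ 1 ∷ 3 ∷ []} avoid213 ∷ []

module _ {A : Set} {R : A → A → Set} where

  AllPairs⇒⊆ : ∀ {xs b c} → AllPairs R xs → b ∷ c ∷ [] ⊆ xs → R b c
  AllPairs⇒⊆ (_  ∷ rxs) (_ ∷ʳ p)   = AllPairs⇒⊆ rxs p
  AllPairs⇒⊆ (rx ∷ _)   (refl ∷ p) = All.lookup rx (to∈ p)

  ⊆⇒AllPairs : ∀ {xs} → (∀ {b c} → b ∷ c ∷ [] ⊆ xs → R b c) → AllPairs R xs
  ⊆⇒AllPairs {[]}     _    = []
  ⊆⇒AllPairs {x ∷ xs} pair = All.tabulate (λ c∈ → pair (refl ∷ from∈ c∈)) ∷ ⊆⇒AllPairs (pair ∘ (x ∷ʳ_))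

  AllPairs-≡ : Asymmetric R → ∀ {xs ys} → AllPairs R xs → AllPairs R ys → (∀ {z} → z ∈ xs ⇔ z ∈ ys) → xs ≡ ys
  AllPairs-≡ asym {[]}     {[]}     _ _ _ = refl
  AllPairs-≡ asym {[]}     {y ∷ ys} _ _ xs⇔ys with () ← from xs⇔ys (here refl)
  AllPairs-≡ asym {x ∷ xs} {[]}     _ _ xs⇔ys with () ← to xs⇔ys (here refl)
  AllPairs-≡ asym {x ∷ xs} {y ∷ ys} (x< ∷ rxs) (y< ∷ rys) xs⇔ys with heads
    where
    heads : x ≡ y
    heads with to xs⇔ys (here refl) | from xs⇔ys (here refl)
    ... | here x≡y   | _          = x≡y
    ... | there _    | here y≡x   = sym y≡x
    ... | there x∈ys | there y∈xs = ⊥-elim (asym (All.lookup x< y∈xs) (All.lookup y< x∈ys))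
  ... | refl = cong (x ∷_) (AllPairs-≡ asym rxs rys (mk⇔ (tail x< (to xs⇔ys)) (tail y< (from xs⇔ys))))
    where
    tail : ∀ {as bs} → All (R x) as → (∀ {z} → z ∈ x ∷ as → z ∈ x ∷ bs) → ∀ {z} → z ∈ as → z ∈ bs
    tail x<as as⊆bs z∈ with as⊆bs (there z∈)
    ... | here refl = ⊥-elim (asym (All.lookup x<as z∈) (All.lookup x<as z∈))
    ... | there z∈′ = z∈′

length-unique-set : ∀ {A : Set} {xs ys : List A} → Unique xs → Unique ys → (∀ {z} → z ∈ xs ⇔ z ∈ ys) →
                    length xs ≡ length ys
length-unique-set uxs uys xs⇔ys = ↭-length (∼bag⇒↭ (unique∧set⇒bag uxs uys xs⇔ys))

module _ {A : Set} (_≟_ : DecidableEquality A) where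

  deduplicate-length⇒Unique : ∀ xs → length (deduplicate _≟_ xs) ≡ length xs → Unique xs
  deduplicate-length⇒Unique []       _   = []
  deduplicate-length⇒Unique (x ∷ xs) len = All.tabulate x≢ ∷ deduplicate-length⇒Unique xs ys≡xs
    where
    ys : List A
    ys = deduplicate _≟_ xs
    P? : ∀ y → Dec (x ≢ y)
    P? = ¬? ∘ (x ≟_)
    kept≤ys : length (filter P? ys) ≤ length ys
    kept≤ys = length-filter P? ys
    ys≤xs : length ys ≤ length xs
    ys≤xs = length-deduplicate _≟_ xs
    ys≡xs : length ys ≡ length xs
    ys≡xs = ≤-antisym ys≤xs (subst (_≤ length ys) (suc-injective len) kept≤ys)
    kept≡ys : filter P? ys ≡ ys
    kept≡ys = filter-complete P? (≤-antisym kept≤ys (subst (length ys ≤_) (sym (suc-injective len)) ys≤xs))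
    x≢ : ∀ {z} → z ∈ xs → x ≢ z
    x≢ z∈ = All.lookup (subst (All _) kept≡ys (Allₚ.all-filter P? ys)) (∈-deduplicate⁺ _≟_ z∈)

Unique-map⁺ : ∀ {A B : Set} {f : A → B} {xs} → (∀ {x y} → x ∈ xs → y ∈ xs → f x ≡ f y → x ≡ y) →
              Unique xs → Unique (map f xs)
Unique-map⁺ inj []         = []
Unique-map⁺ inj (x∉ ∷ uxs) =
  Allₚ.map⁺ (All.tabulate λ y∈ fx≡fy → All.lookup x∉ y∈ (inj (here refl) (there y∈) fx≡fy)) ∷
  Unique-map⁺ (λ x∈ y∈ → inj (there x∈) (there y∈)) uxs

-- Permutations avoiding 132, 213 and 312

-- Before t b c: b comes before c in the sequence t, t+1, t+2, … followed by t−1, t−2, …, 0.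
Before : ℕ → ℕ → ℕ → Set
Before t b c = (t ≤ b × b < c) ⊎ (c < t × c < b)

Before-asym : ∀ {t} → Asymmetric (Before t)
Before-asym (inj₁ (_ , b<c)) (inj₁ (_ , c<b)) = <-asym b<c c<b
Before-asym (inj₁ (t≤b , _)) (inj₂ (b<t , _)) = <⇒≱ b<t t≤b
Before-asym (inj₂ (c<t , _)) (inj₁ (t≤c , _)) = <⇒≱ c<t t≤c
Before-asym (inj₂ (_ , c<b)) (inj₂ (_ , b<c)) = <-asym c<b b<c

Before-ascent : ∀ {t b c} → Before t b c → b < c → t ≤ b
Before-ascent (inj₁ (t≤b , _)) _   = t≤b
Before-ascent (inj₂ (_ , c<b)) b<c = ⊥-elim (<-asym b<c c<b)

Before-descent : ∀ {t b c} → Before t b c → c < b → c < t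
Before-descent (inj₁ (_ , b<c)) c<b = ⊥-elim (<-asym b<c c<b)
Before-descent (inj₂ (c<t , _)) _   = c<t

Before-head : ∀ {x c} → x ≢ c → Before x x c
Before-head {x} {c} x≢c with <-cmp x c
... | tri< x<c _ _ = inj₁ (≤-refl , x<c)
... | tri≈ _ x≡c _ = ⊥-elim (x≢c x≡c)
... | tri> _ _ c<x = inj₂ (c<x , c<x)

avoiding⇒Before : ∀ {x b c} → x ≢ c → b ≢ c →
                  ¬ (x < c × c < b) → ¬ (b < x × x < c) → ¬ (b < c × c < x) → Before x b c
avoiding⇒Before {x} {b} {c} x≢c b≢c no132 no213 no312 with <-cmp b c | <-cmp c x
... | tri≈ _ b≡c _ | _            = ⊥-elim (b≢c b≡c)
... | _            | tri≈ _ c≡x _ = ⊥-elim (x≢c (sym c≡x))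
... | tri< b<c _ _ | tri< c<x _ _ = ⊥-elim (no312 (b<c , c<x))
... | tri< b<c _ _ | tri> _ _ x<c = inj₁ (≮⇒≥ (λ b<x → no213 (b<x , x<c)) , b<c)
... | tri> _ _ c<b | tri< c<x _ _ = inj₂ (c<x , c<b)
... | tri> _ _ c<b | tri> _ _ x<c = ⊥-elim (no132 (x<c , c<b))

AvoidsAll-Π₁⇒AllPairs-Before : ∀ {x τ} → Unique (x ∷ τ) → AvoidsAll Π₁ (x ∷ τ) → AllPairs (Before x) (x ∷ τ)
AvoidsAll-Π₁⇒AllPairs-Before {x} {τ} unique (avoid132 ∷ avoid213 ∷ avoid312 ∷ []) = ⊆⇒AllPairs pair
  where
  distinct : ∀ {b c} → b ∷ c ∷ [] ⊆ x ∷ τ → b ≢ c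
  distinct = AllPairs⇒⊆ unique
  pair : ∀ {b c} → b ∷ c ∷ [] ⊆ x ∷ τ → Before x b c
  pair (refl ∷ p)       = Before-head (distinct (refl ∷ p))
  pair {b} {c} (_ ∷ʳ p) = avoiding⇒Before (distinct (refl ∷ ⊆-trans (b ∷ʳ refl ∷ []) p)) (distinct (x ∷ʳ p))
    (λ (x<c , c<b) → avoid132 (_ , xbc , x , c , b , x<c , c<b , refl))
    (λ (b<x , x<c) → avoid213 (_ , xbc , b , x , c , b<x , x<c , refl))
    (λ (b<c , c<x) → avoid312 (_ , xbc , b , c , x , b<c , c<x , refl))
    where
    xbc : x ∷ b ∷ c ∷ [] ⊆ x ∷ τ
    xbc = refl ∷ p

AllPairs-Before⇒AvoidsAll-Π₁ : ∀ {t σ} → AllPairs (Before t) σ → AvoidsAll Π₁ σ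
AllPairs-Before⇒AvoidsAll-Π₁ {t} {σ} sorted = avoid132 ∷ avoid213 ∷ avoid312 ∷ []
  where
  before : ∀ {a b c} → a ∷ b ∷ c ∷ [] ⊆ σ → Before t a b × Before t a c × Before t b c
  before p = AllPairs⇒⊆ sorted (⊆-trans (refl ∷ refl ∷ _ ∷ʳ []) p) ,
             AllPairs⇒⊆ sorted (⊆-trans (refl ∷ _ ∷ʳ refl ∷ []) p) ,
             AllPairs⇒⊆ sorted (⊆-trans (_ ∷ʳ refl ∷ refl ∷ []) p)
  avoid132 : Avoids (1 ∷ 3 ∷ 2 ∷ []) σ
  avoid132 (_ , p , x , y , z , x<y , y<z , refl) with before p
  ... | _ , xy , zy = <-asym x<y (<-≤-trans (Before-descent zy y<z) (Before-ascent xy x<y))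
  avoid213 : Avoids (2 ∷ 1 ∷ 3 ∷ []) σ
  avoid213 (_ , p , x , y , z , x<y , y<z , refl) with before p
  ... | yx , _ , xz = <⇒≱ (Before-descent yx x<y) (Before-ascent xz (<-trans x<y y<z))
  avoid312 : Avoids (3 ∷ 1 ∷ 2 ∷ []) σ
  avoid312 (_ , p , x , y , z , x<y , y<z , refl) with before p
  ... | zx , _ , xy = <⇒≱ (Before-descent zx (<-trans x<y y<z)) (Before-ascent xy x<y)

ascending : ℕ → ℕ → List ℕ
ascending m zero    = []
ascending m (suc p) = m ∷ ascending (suc m) p

descending : ℕ → ℕ → List ℕ
descending m zero    = []
descending m (suc r) = m + r ∷ descending m r

upDown : ℕ → ℕ → List ℕ
upDown n x = x ∷ ascending (suc x) (n ∸ suc x) ++ descending 0 x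

length-ascending : ∀ m p → length (ascending m p) ≡ p
length-ascending m zero    = refl
length-ascending m (suc p) = cong suc (length-ascending (suc m) p)

length-descending : ∀ m r → length (descending m r) ≡ r
length-descending m zero    = refl
length-descending m (suc r) = cong suc (length-descending m r)

∈-ascending⁻ : ∀ {e} m p → e ∈ ascending m p → m ≤ e × e < m + p
∈-ascending⁻ m (suc p) (here refl) = ≤-refl , m<m+n m z<s
∈-ascending⁻ {e} m (suc p) (there e∈) with ∈-ascending⁻ (suc m) p e∈
... | m<e , e<1+m+p = <⇒≤ m<e , subst (e <_) (sym (+-suc m p)) e<1+m+p

∈-ascending⁺ : ∀ {e} m p → m ≤ e → e < m + p → e ∈ ascending m p
∈-ascending⁺ {e} m zero m≤e e<m+0 = ⊥-elim (<⇒≱ (subst (e <_) (+-identityʳ m) e<m+0) m≤e)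
∈-ascending⁺ {e} m (suc p) m≤e e<m+1+p with m ≟ e
... | yes refl = here refl
... | no  m≢e  = there (∈-ascending⁺ (suc m) p (≤∧≢⇒< m≤e m≢e) (subst (e <_) (+-suc m p) e<m+1+p))

descending-∷ʳ : ∀ m r → descending (suc m) r ++ [ m ] ≡ descending m (suc r)
descending-∷ʳ m zero    = cong (_∷ []) (sym (+-identityʳ m))
descending-∷ʳ m (suc r) = cong₂ _∷_ (sym (+-suc m r)) (descending-∷ʳ m r)

reverse-ascending : ∀ m p → reverse (ascending m p) ≡ descending m p
reverse-ascending m zero    = refl
reverse-ascending m (suc p) = begin
  reverse (m ∷ ascending (suc m) p)      ≡⟨ unfold-reverse m (ascending (suc m) p) ⟩
  reverse (ascending (suc m) p) ++ [ m ] ≡⟨ cong (_++ [ m ]) (reverse-ascending (suc m) p) ⟩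
  descending (suc m) p ++ [ m ]          ≡⟨ descending-∷ʳ m p ⟩
  descending m (suc p)                   ∎

reverse-descending : ∀ m r → reverse (descending m r) ≡ ascending m r
reverse-descending m r = begin
  reverse (descending m r)           ≡⟨ cong reverse (reverse-ascending m r) ⟨
  reverse (reverse (ascending m r))  ≡⟨ reverse-involutive _ ⟩
  ascending m r                      ∎

∈-descending⁻ : ∀ {e} m r → e ∈ descending m r → m ≤ e × e < m + r
∈-descending⁻ m r e∈ = ∈-ascending⁻ m r (∈-reverse⁻ (subst (_ ∈_) (sym (reverse-ascending m r)) e∈))

∈-descending⁺ : ∀ {e} m r → m ≤ e → e < m + r → e ∈ descending m r
∈-descending⁺ m r m≤e e< = subst (_ ∈_) (reverse-ascending m r) (∈-reverse⁺ (∈-ascending⁺ m r m≤e e<))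

reverse-upDown : ∀ n y → reverse (upDown n y) ≡ ascending 0 y ++ descending y (suc (n ∸ suc y))
reverse-upDown n y = begin
  reverse (ascending y (suc p) ++ descending 0 y)            ≡⟨ reverse-++ (ascending y (suc p)) _ ⟩
  reverse (descending 0 y) ++ reverse (ascending y (suc p))
    ≡⟨ cong₂ _++_ (reverse-descending 0 y) (reverse-ascending y (suc p)) ⟩
  ascending 0 y ++ descending y (suc p)                      ∎
  where p = n ∸ suc y

ascending-sorted : ∀ {t} m p → t ≤ m → AllPairs (Before t) (ascending m p)
ascending-sorted m zero    _   = []
ascending-sorted m (suc p) t≤m =
  All.tabulate (λ c∈ → inj₁ (t≤m , proj₁ (∈-ascending⁻ (suc m) p c∈))) ∷
  ascending-sorted (suc m) p (m≤n⇒m≤1+n t≤m)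

descending-sorted : ∀ {t} r → r ≤ t → AllPairs (Before t) (descending 0 r)
descending-sorted zero    _     = []
descending-sorted (suc r) 1+r≤t =
  All.tabulate (λ c∈ → let c<r = proj₂ (∈-descending⁻ 0 r c∈) in inj₂ (<-trans c<r 1+r≤t , c<r)) ∷
  descending-sorted r (<⇒≤ 1+r≤t)

upDown-sorted : ∀ n x → AllPairs (Before x) (upDown n x)
upDown-sorted n x = AllPairsₚ.++⁺ (ascending-sorted x (suc (n ∸ suc x)) ≤-refl) (descending-sorted x ≤-refl)
  (All.tabulate λ b∈ → All.tabulate λ c∈ →
    let c<x = proj₂ (∈-descending⁻ 0 x c∈) in inj₂ (c<x , <-≤-trans c<x (proj₁ (∈-ascending⁻ x _ b∈))))

IsPermutation : ℕ → List ℕ → Set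
IsPermutation n σ = length σ ≡ n × (∀ {k} → k ∈ σ ⇔ k < n)

upDown-permutation : ∀ {n x} → x < n → IsPermutation n (upDown n x)
upDown-permutation {n} {x} x<n = length≡n , mk⇔ bounded complete
  where
  p : ℕ
  p = n ∸ suc x
  1+x+p≡n : suc x + p ≡ n
  1+x+p≡n = m+[n∸m]≡n x<n
  length≡n : length (upDown n x) ≡ n
  length≡n = begin
    suc (length (ascending (suc x) p ++ descending 0 x))  ≡⟨ cong suc (length-++ (ascending (suc x) p)) ⟩
    suc (length (ascending (suc x) p) + length (descending 0 x))
      ≡⟨ cong suc (cong₂ _+_ (length-ascending (suc x) p) (length-descending 0 x)) ⟩
    suc (p + x)                                           ≡⟨ cong suc (+-comm p x) ⟩
    suc x + p                                             ≡⟨ 1+x+p≡n ⟩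
    n                                                     ∎
  bounded : ∀ {k} → k ∈ upDown n x → k < n
  bounded (here refl) = x<n
  bounded {k} (there k∈) with ∈-++⁻ (ascending (suc x) p) k∈
  ... | inj₁ k∈↑ = subst (k <_) 1+x+p≡n (proj₂ (∈-ascending⁻ (suc x) p k∈↑))
  ... | inj₂ k∈↓ = <-trans (proj₂ (∈-descending⁻ 0 x k∈↓)) x<n
  complete : ∀ {k} → k < n → k ∈ upDown n x
  complete {k} k<n with <-cmp k x
  ... | tri< k<x _ _  = there (∈-++⁺ʳ (ascending (suc x) p) (∈-descending⁺ 0 x z≤n k<x))
  ... | tri≈ _ refl _ = here refl
  ... | tri> _ _ x<k  = there (∈-++⁺ˡ (∈-ascending⁺ (suc x) p x<k (subst (k <_) (sym 1+x+p≡n) k<n)))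

IsPermutation-reverse : ∀ {n σ} → IsPermutation n σ → IsPermutation n (reverse σ)
IsPermutation-reverse {σ = σ} (len , mem) =
  trans (length-reverse σ) len , mk⇔ (to mem ∘ ∈-reverse⁻) (∈-reverse⁺ ∘ from mem)

IsPermutation⇒Unique : ∀ {n σ} → IsPermutation n σ → Unique σ
IsPermutation⇒Unique {n} {σ} (len , mem) = deduplicate-length⇒Unique _≟_ σ (begin
  length (deduplicate _≟_ σ)  ≡⟨ length-unique-set (deduplicate-! σ) (Unique.upTo⁺ n) dedup⇔upTo ⟩
  length (upTo n)             ≡⟨ length-upTo n ⟩
  n                           ≡⟨ len ⟨
  length σ                    ∎)
  where
  dedup⇔upTo : ∀ {k} → k ∈ deduplicate _≟_ σ ⇔ k ∈ upTo n
  dedup⇔upTo = mk⇔ (∈-upTo⁺ ∘ to mem ∘ ∈-deduplicate⁻ _≟_ σ) (∈-deduplicate⁺ _≟_ ∘ from mem ∘ ∈-upTo⁻)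

AvoidsAll-Π₁⇒upDown : ∀ {n σ} → 0 < n → IsPermutation n σ → AvoidsAll Π₁ σ → ∃[ x ] x < n × σ ≡ upDown n x
AvoidsAll-Π₁⇒upDown {σ = []}    0<n (len , _)    _     = ⊥-elim (<-irrefl len 0<n)
AvoidsAll-Π₁⇒upDown {n} {x ∷ τ} 0<n perm@(_ , mem) avoid = x , x<n ,
  AllPairs-≡ Before-asym (AvoidsAll-Π₁⇒AllPairs-Before (IsPermutation⇒Unique perm) avoid) (upDown-sorted n x)
    (⇔-trans mem (⇔-sym (proj₂ (upDown-permutation x<n))))
  where
  x<n : x < n
  x<n = to mem (here refl)

-- The ballot condition

ballotFrom-ascending : ∀ d t r w → ballotFrom d t (ascending (suc t) r ++ w) ≡ ballotFrom (d + r) (t + r) w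
ballotFrom-ascending d t zero    w rewrite +-identityʳ d | +-identityʳ t = refl
ballotFrom-ascending d t (suc r) w rewrite <ᵇ≡true (n<1+n t) | +-suc d r | +-suc t r =
  ballotFrom-ascending (suc d) (suc t) r w

-- r <ᵇ suc d rather than r ≤ᵇ d: it reduces in step with the recursion on r and d
ballotFrom-descending : ∀ d t m r → m + r ≤ t → ballotFrom d t (descending m r) ≡ (r <ᵇ suc d)
ballotFrom-descending d       t m zero    _       = refl
ballotFrom-descending d       t m (suc r) m+1+r≤t
  rewrite <ᵇ≡false (<⇒≯ (subst (_≤ t) (+-suc m r) m+1+r≤t)) with d
... | zero   = refl
... | suc d′ = ballotFrom-descending d′ (m + r) m r ≤-refl

upDown-ballot : ∀ n x → T (isBallotᵇ (upDown n x)) ⇔ x ≤ n ∸ suc x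
upDown-ballot n x = subst (λ b → T b ⇔ x ≤ p) (sym isBallot≡) T-<ᵇ-suc
  where
  p : ℕ
  p = n ∸ suc x
  isBallot≡ : isBallotᵇ (upDown n x) ≡ (x <ᵇ suc p)
  isBallot≡ = trans (ballotFrom-ascending 0 x p (descending 0 x))
                    (ballotFrom-descending p (x + p) 0 x (m≤m+n x p))

isBallot-reverse-upDown : ∀ n y → isBallotᵇ (reverse (upDown n y)) ≡ (n ∸ suc y <ᵇ suc y)
isBallot-reverse-upDown n y rewrite reverse-upDown n y = ballot y (n ∸ suc y)
  where
  ballot : ∀ y p → isBallotᵇ (ascending 0 y ++ descending y (suc p)) ≡ (p <ᵇ suc y)
  ballot zero    p = ballotFrom-descending 0 p 0 p ≤-refl
  ballot (suc y) p
    rewrite ballotFrom-ascending 0 0 y (descending (suc y) (suc p)) | <ᵇ≡true (s≤s (m≤m+n y p)) =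
    ballotFrom-descending (suc y) (suc y + p) (suc y) p ≤-refl

isPermᵇ⇔ : ∀ {n w} → T (isPermᵇ n w) ⇔ (length w ≡ n × (∀ {k} → k < n → k ∈ w))
isPermᵇ⇔ {n} {w} = mk⇔
  (λ t → let len , cover = to T-∧ t in
    ≡ᵇ⇒≡ _ _ len ,
    λ {k} k<n → to (elemᵇ⇔∈ {k}) (All.lookup (all⁺ (λ k → elemᵇ k w) (upTo n) cover) (∈-upTo⁺ k<n)))
  (λ (len , cover) →
    from T-∧ (≡⇒≡ᵇ _ _ len ,
              all⁻ (λ k → elemᵇ k w) (All.tabulate (λ k∈ → from elemᵇ⇔∈ (cover (∈-upTo⁻ k∈))))))

∈-words⁺ : ∀ {m n w} → length w ≡ n → All (_< m) w → w ∈ words m n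
∈-words⁺ {n = zero} {[]} refl [] = here refl
∈-words⁺ {m} {suc n} {x ∷ w} len (x<m ∷ w<m) =
  ∈-concatMap⁺ (λ y → map (y ∷_) (words m n))
    (lose (∈-upTo⁺ x<m) (∈-map⁺ (x ∷_) (∈-words⁺ (suc-injective len) w<m)))

∈-words⁻ : ∀ {m n w} → w ∈ words m n → length w ≡ n × All (_< m) w
∈-words⁻ {n = zero}  (here refl) = refl , []
∈-words⁻ {m} {suc n} w∈ with find (∈-concatMap⁻ (λ x → map (x ∷_) (words m n)) {xs = upTo m} w∈)
... | x , x∈ , xw∈ with ∈-map⁻ (x ∷_) xw∈
...   | w , w∈ , refl = Product.map (cong suc) (∈-upTo⁻ x∈ ∷_) (∈-words⁻ w∈)

words-unique : ∀ m n → Unique (words m n)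
words-unique m zero    = [] ∷ []
words-unique m (suc n) = Unique.concat⁺
  (Allₚ.map⁺ (All.universal (λ x → Unique.map⁺ ∷-injectiveʳ (words-unique m n)) (upTo m)))
  (AllPairsₚ.map⁺ (AllPairs.map disjoint (Unique.upTo⁺ m)))
  where
  disjoint : ∀ {x y} → x ≢ y → Disjoint (map (x ∷_) (words m n)) (map (y ∷_) (words m n))
  disjoint x≢y (xw∈ , yw∈) with ∈-map⁻ _ xw∈ | ∈-map⁻ _ yw∈
  ... | _ , _ , refl | _ , _ , refl = x≢y refl

∈-perms⇔ : ∀ {n σ} → σ ∈ perms n ⇔ IsPermutation n σ
∈-perms⇔ {n} {σ} = mk⇔ permutation generated
  where
  permutation : σ ∈ perms n → IsPermutation n σ
  permutation σ∈ with ∈-filter⁻ (λ w → T? (isPermᵇ n w)) {xs = words n n} σ∈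
  ... | σ∈words , t with to (isPermᵇ⇔ {n} {σ}) t
  ...   | length≡n , complete = length≡n , mk⇔ (All.lookup (proj₂ (∈-words⁻ {n} {n} σ∈words))) complete
  generated : IsPermutation n σ → σ ∈ perms n
  generated (len , mem) = ∈-filter⁺ (λ w → T? (isPermᵇ n w))
    (∈-words⁺ len (All.tabulate (to mem))) (from (isPermᵇ⇔ {n} {σ}) (len , from mem))

∈-B⇔ : ∀ {n πs σ} → σ ∈ B n πs ⇔ (IsPermutation n σ × T (isBallotᵇ σ) × T (avoidsAllᵇ σ πs))
∈-B⇔ {n} {πs} {σ} = mk⇔
  (λ σ∈ → let σ∈perms , t = ∈-filter⁻ test {xs = perms n} σ∈ in to ∈-perms⇔ σ∈perms , to T-∧ t)
  (λ (perm , t) → ∈-filter⁺ test (from ∈-perms⇔ perm) (from T-∧ t))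
  where
  test : ∀ σ → Dec (T (isBallotᵇ σ ∧ avoidsAllᵇ σ πs))
  test σ = T? (isBallotᵇ σ ∧ avoidsAllᵇ σ πs)

B-unique : ∀ n πs → Unique (B n πs)
B-unique n πs = Unique.filter⁺ _ (Unique.filter⁺ _ (words-unique n n))

-- Counting

∸-suc-involutive : ∀ {n y} → y < n → n ∸ suc (n ∸ suc y) ≡ y
∸-suc-involutive (s≤s y≤n) = m∸[m∸n]≡n y≤n

∸-suc-< : ∀ {n y} → y < n → n ∸ suc y < n
∸-suc-< {suc n} {y} _ = s≤s (m∸n≤m n y)

-- indexed by x = n−1−y, so that it has the same ballot condition as upDown n x
reverseUpDown : ℕ → ℕ → List ℕ
reverseUpDown n x = reverse (upDown n (n ∸ suc x))

reverseUpDown-ballot : ∀ {n x} → x < n → T (isBallotᵇ (reverseUpDown n x)) ⇔ x ≤ n ∸ suc x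
reverseUpDown-ballot {n} {x} x<n = subst (λ b → T b ⇔ x ≤ n ∸ suc x) (sym isBallot≡) T-<ᵇ-suc
  where
  isBallot≡ : isBallotᵇ (reverseUpDown n x) ≡ (x <ᵇ suc (n ∸ suc x))
  isBallot≡ = trans (isBallot-reverse-upDown n (n ∸ suc x))
                    (cong (_<ᵇ suc (n ∸ suc x)) (∸-suc-involutive x<n))

upDown-characterisation : ∀ {n σ} → 0 < n →
                          (IsPermutation n σ × AvoidsAll Π₁ σ) ⇔ (∃[ x ] x < n × σ ≡ upDown n x)
upDown-characterisation {n} 0<n = mk⇔
  (λ (perm , avoid) → AvoidsAll-Π₁⇒upDown 0<n perm avoid)
  (λ { (x , x<n , refl) → upDown-permutation x<n , AllPairs-Before⇒AvoidsAll-Π₁ (upDown-sorted n x) })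

reverseUpDown-characterisation : ∀ {n σ} → 0 < n →
                                 (IsPermutation n σ × AvoidsAll Π₂ σ) ⇔ (∃[ x ] x < n × σ ≡ reverseUpDown n x)
reverseUpDown-characterisation {n} {σ} 0<n = mk⇔ shape avoiding
  where
  shape : IsPermutation n σ × AvoidsAll Π₂ σ → ∃[ x ] x < n × σ ≡ reverseUpDown n x
  shape (perm , avoid)
    with to (upDown-characterisation 0<n) (IsPermutation-reverse perm , AvoidsAll-Π₂-reverse avoid)
  ... | y , y<n , σʳ≡upDown = n ∸ suc y , ∸-suc-< y<n , (begin
    σ                            ≡⟨ reverse-involutive σ ⟨
    reverse (reverse σ)          ≡⟨ cong reverse σʳ≡upDown ⟩
    reverse (upDown n y)         ≡⟨ cong (reverse ∘ upDown n) (∸-suc-involutive y<n) ⟨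
    reverseUpDown n (n ∸ suc y)  ∎)
  avoiding : ∃[ x ] x < n × σ ≡ reverseUpDown n x → IsPermutation n σ × AvoidsAll Π₂ σ
  avoiding (x , x<n , refl) with from (upDown-characterisation 0<n) (n ∸ suc x , ∸-suc-< x<n , refl)
  ... | perm , avoid = IsPermutation-reverse perm , AvoidsAll-Π₁-reverse avoid

indices : ℕ → List ℕ
indices n = filter (λ x → x ≤? n ∸ suc x) (upTo n)

∈-indices⇔ : ∀ {n x} → x ∈ indices n ⇔ (x < n × x ≤ n ∸ suc x)
∈-indices⇔ {n} = mk⇔ (Product.map₁ ∈-upTo⁻ ∘ ∈-filter⁻ (λ x → x ≤? n ∸ suc x))
                     (λ (x<n , x≤) → ∈-filter⁺ (λ x → x ≤? n ∸ suc x) (∈-upTo⁺ x<n) x≤)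

indices-unique : ∀ n → Unique (indices n)
indices-unique n = Unique.filter⁺ _ (Unique.upTo⁺ n)

∈-B⇔∈-map-indices : ∀ {n πs} (shape : ℕ → List ℕ) → All Pattern₃ πs →
  (∀ {σ} → (IsPermutation n σ × AvoidsAll πs σ) ⇔ (∃[ x ] x < n × σ ≡ shape x)) →
  (∀ {x} → x < n → T (isBallotᵇ (shape x)) ⇔ x ≤ n ∸ suc x) →
  ∀ {σ} → σ ∈ B n πs ⇔ σ ∈ map shape (indices n)
∈-B⇔∈-map-indices {n} {πs} shape Ps characterisation ballot {σ} = mk⇔ index generate
  where
  index : σ ∈ B n πs → σ ∈ map shape (indices n)
  index σ∈ with to (∈-B⇔ {n} {πs}) σ∈
  ... | perm , isBallot , avoid with to characterisation (perm , to (avoidsAll⇔ {σ = σ} Ps) avoid)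
  ...   | x , x<n , refl = ∈-map⁺ shape (from ∈-indices⇔ (x<n , to (ballot x<n) isBallot))
  generate : σ ∈ map shape (indices n) → σ ∈ B n πs
  generate σ∈ with ∈-map⁻ shape σ∈
  ... | x , x∈ , refl with to ∈-indices⇔ x∈
  ...   | x<n , x≤ with from characterisation (x , x<n , refl)
  ...     | perm , avoid =
    from (∈-B⇔ {n} {πs}) (perm , from (ballot x<n) x≤ , from (avoidsAll⇔ {σ = shape x} Ps) avoid)

upDowns-unique : ∀ n → Unique (map (upDown n) (indices n))
upDowns-unique n = Unique.map⁺ ∷-injectiveˡ (indices-unique n)

reverseUpDown-injective : ∀ {n x y} → x < n → y < n → reverseUpDown n x ≡ reverseUpDown n y → x ≡ y
reverseUpDown-injective {n} {x} {y} x<n y<n eq = begin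
  x                    ≡⟨ ∸-suc-involutive x<n ⟨
  n ∸ suc (n ∸ suc x)  ≡⟨ cong (λ z → n ∸ suc z) heads ⟩
  n ∸ suc (n ∸ suc y)  ≡⟨ ∸-suc-involutive y<n ⟩
  y                    ∎
  where
  heads : n ∸ suc x ≡ n ∸ suc y
  heads = ∷-injectiveˡ (reverse-injective {x = upDown n (n ∸ suc x)} {upDown n (n ∸ suc y)} eq)

reverseUpDowns-unique : ∀ n → Unique (map (reverseUpDown n) (indices n))
reverseUpDowns-unique n = Unique-map⁺
  (λ x∈ y∈ → reverseUpDown-injective (proj₁ (to (∈-indices⇔ {n}) x∈)) (proj₁ (to (∈-indices⇔ {n}) y∈)))
  (indices-unique n)

theorem4p3 : (n : ℕ) → 1 Data.Nat.≤ n →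
    ∣B∣ n ((1 ∷ 3 ∷ 2 ∷ []) ∷ (2 ∷ 1 ∷ 3 ∷ []) ∷ (3 ∷ 1 ∷ 2 ∷ []) ∷ [])
      ≡ ∣B∣ n ((2 ∷ 1 ∷ 3 ∷ []) ∷ (2 ∷ 3 ∷ 1 ∷ []) ∷ (3 ∷ 1 ∷ 2 ∷ []) ∷ [])
theorem4p3 n 0<n = begin
  length (B n Π₁)                             ≡⟨ length-unique-set (B-unique n Π₁) (upDowns-unique n) B-Π₁⇔ ⟩
  length (map (upDown n) (indices n))         ≡⟨ length-map (upDown n) (indices n) ⟩
  length (indices n)                          ≡⟨ length-map (reverseUpDown n) (indices n) ⟨
  length (map (reverseUpDown n) (indices n))  ≡⟨ length-unique-set (B-unique n Π₂) (reverseUpDowns-unique n) B-Π₂⇔ ⟨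
  length (B n Π₂)                             ∎
  where
  B-Π₁⇔ : ∀ {σ} → σ ∈ B n Π₁ ⇔ σ ∈ map (upDown n) (indices n)
  B-Π₁⇔ = ∈-B⇔∈-map-indices (upDown n) Π₁-patterns (upDown-characterisation 0<n) (λ {x} _ → upDown-ballot n x)
  B-Π₂⇔ : ∀ {σ} → σ ∈ B n Π₂ ⇔ σ ∈ map (reverseUpDown n) (indices n)
  B-Π₂⇔ = ∈-B⇔∈-map-indices (reverseUpDown n) Π₂-patterns (reverseUpDown-characterisation 0<n)
                            reverseUpDown-ballot
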